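{- Let $G\in\mathfrak{D}$, $H\in\mathfrak{D}_r$, and let $\mathcal{L}$ be a set of subgraphs of $G$. For every $\zeta\in\mathcal{M}^{\mathcal{L}}(G,H)$, the map $\gamma^{\mathcal{L}}_\zeta:A(G^*)\to\mathbb{N}_0$ defined by $$\gamma^{\mathcal{L}}_\zeta(v,w)=\iota_\zeta(v,w)\cdot\#\{L\in\mathcal{L}: vw\in A(L^*)\}$$ is a $\zeta$-selecting arc weight of $G$ within $\mathcal{H}(G,H)$.
   Context: A digraph $G=(V(G),A(G))$ has finite nonempty vertex set and arc set $A(G)\subseteq V(G)\times V(G)$; $vw$ denotes $(v,w)$; $G^*$ is $G$ with loops removed. $\mathfrak{D}$: all digraphs; $\mathfrak{D}_r$: reflexive digraphs. $\mathcal{H}(G,H)$ is the set of homomorphisms $G\to H$. A subgraph $L$ of $G$ has $V(L)\subseteq V(G)$, $A(L)\subseteq A(G)$; $\xi|_L$ is the restriction of $\xi$ to $V(L)$. For $vw\in A(H)$, $[v,w]_H=\{u: vu,uw\in A(H)\}$, $\iota(v,w)_H=\#[v,w]_H$; for $\xi\in\mathcal{H}(G,H)$, $\iota_\xi(v,w)=\iota(\xi(v),\xi(w))_H$ ($vw\in A(G)$), and for $B\subseteq A(G^*)$, $\iota_{\xi,B}$ is the restriction of $\iota_\xi$ to $B$. $\mu_\xi(G)=\sum_{vw\in A(G^*)}\iota_\xi(v,w)$; $\hat\mu(L,H)=\max\{\mu_\xi(L):\xi\in\mathcal{H}(L,H)\}$; $\mathcal{M}(L,H)=\{\xi\in\mathcal{H}(L,H):\mu_\xi(L)=\hat\mu(L,H)\}$;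 $\mathcal{M}^{\mathcal{L}}(G,H)=\{\xi\in\mathcal{H}(G,H):\xi|_L\in\mathcal{M}(L,H)\ \forall L\in\mathcal{L}\}$. An arc weight of $G$ is a map $\alpha:A(G^*)\to\mathbb{N}_0$; $D(\alpha)=\{vw\in A(G^*):\alpha(v,w)>0\}$; for $\xi\in\mathcal{H}(G,H)$ with $H$ reflexive, $\pi_\alpha(\xi)=\prod_{vw\in A(G^*)}\iota_\xi(v,w)^{\alpha(v,w)}$. For $\zeta\in\mathcal{H}(G,H)$, $\alpha$ is $\zeta$-selecting within $\mathcal{H}(G,H)$ if for all $\xi\in\mathcal{H}(G,H)$, $\pi_\alpha(\xi)\le\pi_\alpha(\zeta)$, with equality iff $\iota_{\xi,D(\alpha)}=\iota_{\zeta,D(\alpha)}$. -}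

module Defs where

open import Data.Nat using (ℕ; zero; suc; _+_; _*_; _^_; _≤_; _<_)
open import Data.Bool using (Bool; true; false; _∧_; not; if_then_else_; T?)
open import Data.Fin using (Fin; _≟_)
open import Data.List using (List; map; allFin; filter; length)
open import Data.Nat.ListAction using (sum; product)
open import Data.List.Membership.Propositional using (_∈_)
open import Data.Vec using (Vec; lookup)
open import Data.Product using (_×_; ∃)
open import Relation.Binary.PropositionalEquality using (_≡_; _≢_)
open import Relation.Nullary.Decidable using (⌊_⌋)
open import Function.Bundles using (_⇔_)

-- A finite digraph with nonempty vertex set V = Fin (suc size)
-- and arc set given by a Boolean adjacency relation (loops allowed).
record Digraph : Set where
  field
    size : ℕ
    arc  : Fin (suc size) → Fin (suc size) → Bool

open Digraph public

V : Digraph → Set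
V G = Fin (suc (size G))

Arc : (G : Digraph) → V G → V G → Set
Arc G v w = arc G v w ≡ true

ArcStar : (G : Digraph) → V G → V G → Set
ArcStar G v w = Arc G v w × v ≢ w

arcStarᵇ : (G : Digraph) → V G → V G → Bool
arcStarᵇ G v w = arc G v w ∧ not ⌊ v ≟ w ⌋

Reflexive : Digraph → Set
Reflexive H = ∀ v → Arc H v v

IsHom : (G H : Digraph) → (V G → V H) → Set
IsHom G H ξ = ∀ v w → Arc G v w → Arc H (ξ v) (ξ w)

sumV : (G : Digraph) → (V G → ℕ) → ℕ
sumV G f = sum (map f (allFin (suc (size G))))

prodV : (G : Digraph) → (V G → ℕ) → ℕ
prodV G f = product (map f (allFin (suc (size G))))

ι : (H : Digraph) → V H → V H → ℕ
ι H v w = length (filter (λ u → T? (arc H v u ∧ arc H u w)) (allFin (suc (size H))))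

ιξ : (G H : Digraph) → (V G → V H) → V G → V G → ℕ
ιξ G H ξ v w = ι H (ξ v) (ξ w)

record Sub (n : ℕ) : Set where
  constructor sub
  field
    vs : Vec Bool n
    as : Vec (Vec Bool n) n

open Sub public

SubG : Digraph → Set
SubG G = Sub (suc (size G))

inV : ∀ {n} → Sub n → Fin n → Bool
inV L v = lookup (vs L) v

inA : ∀ {n} → Sub n → Fin n → Fin n → Bool
inA L v w = lookup (lookup (as L) v) w

IsSubgraph : (G : Digraph) → Sub (suc (size G)) → Set
IsSubgraph G L =
  (∃ λ v → inV L v ≡ true) ×
  (∀ v w → inA L v w ≡ true → Arc G v w) ×
  (∀ v w → inA L v w ≡ true → inV L v ≡ true × inV L w ≡ true)

arcLStarᵇ : (G : Digraph) → Sub (suc (size G)) → V G → V G → Bool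
arcLStarᵇ G L v w = inA L v w ∧ not ⌊ v ≟ w ⌋

-- Homomorphisms L → H, represented by maps on V(G) (values outside V(L)
-- are irrelevant; every homomorphism on V(L) extends since V(H) ≠ ∅).
IsHomSub : (G : Digraph) → Sub (suc (size G)) → (H : Digraph) → (V G → V H) → Set
IsHomSub G L H ξ = ∀ v w → inA L v w ≡ true → Arc H (ξ v) (ξ w)

μ : (G : Digraph) → Sub (suc (size G)) → (H : Digraph) → (V G → V H) → ℕ
μ G L H ξ = sumV G (λ v → sumV G (λ w →
  if arcLStarᵇ G L v w then ιξ G H ξ v w else 0))

InM : (G : Digraph) → Sub (suc (size G)) → (H : Digraph) → (V G → V H) → Set
InM G L H ξ = IsHomSub G L H ξ ×
  (∀ ψ → IsHomSub G L H ψ → μ G L H ψ ≤ μ G L H ξ)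

InML : (G H : Digraph) → List (Sub (suc (size G))) → (V G → V H) → Set
InML G H 𝓛 ζ = IsHom G H ζ × (∀ L → L ∈ 𝓛 → InM G L H ζ)

-- arc weights of G: maps A(G*) → ℕ; represented as maps on all pairs,
-- only values on A(G*) are ever used.
ArcWeight : Digraph → Set
ArcWeight G = V G → V G → ℕ

π : (G H : Digraph) → ArcWeight G → (V G → V H) → ℕ
π G H α ξ = prodV G (λ v → prodV G (λ w →
  if arcStarᵇ G v w then ιξ G H ξ v w ^ α v w else 1))

AgreeOnD : (G H : Digraph) → ArcWeight G → (V G → V H) → (V G → V H) → Set
AgreeOnD G H α ξ ζ =
  ∀ v w → ArcStar G v w → 0 < α v w → ιξ G H ξ v w ≡ ιξ G H ζ v w

Selecting : (G H : Digraph) → ArcWeight G → (V G → V H) → Set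
Selecting G H α ζ = ∀ ξ → IsHom G H ξ →
  (π G H α ξ ≤ π G H α ζ) × (π G H α ξ ≡ π G H α ζ ⇔ AgreeOnD G H α ξ ζ)

γ : (G H : Digraph) → List (Sub (suc (size G))) → (V G → V H) → ArcWeight G
γ G H 𝓛 ζ v w = ιξ G H ζ v w * length (filter (λ L → T? (arcLStarᵇ G L v w)) 𝓛)

module Submission where

-- The theorem is a consequence of Gibbs' inequality over the naturals:
--
--   if  Σ bᵢ ≤ Σ aᵢ  then  Π bᵢ^aᵢ ≤ Π aᵢ^aᵢ,  with equality only if
--   bᵢ = aᵢ wherever aᵢ > 0.
--
-- Writing ιᴸ_ξ for ι_ξ restricted to A(L*) (and 0 elsewhere), the product
-- π_γ(ξ) factors as Π_{L ∈ 𝓛} Π_{vw} (ιᴸ_ξ(v,w))^(ιᴸ_ζ(v,w)), because the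
-- exponent γ(v,w) counts the subgraphs L containing vw (and 0⁰ = 1).
-- Since ζ maximises μ_·(L) = Σ_{vw} ιᴸ_·(v,w) for every L ∈ 𝓛, Gibbs'
-- inequality bounds each factor by its value at ζ, and equality of the
-- products forces equality of every factor, hence ιᴸ_ξ = ιᴸ_ζ where
-- ιᴸ_ζ > 0, which covers D(γ).

open import Defs

open import Data.Bool using (Bool; true; false; if_then_else_; T?)
open import Data.Fin using (_≟_)
open import Data.Nat hiding (_≟_)
open import Data.Nat.Properties hiding (_≟_)
open import Data.Nat.Tactic.RingSolver using (solve-∀)
open import Data.Nat.ListAction using (sum; product)
open import Data.Nat.ListAction.Properties using (sum-++; product-++)
open import Data.List using (List; []; _∷_; map; foldr; _++_; cartesianProduct; filter; length; allFin)
open import Data.List.Properties using (map-++; map-∘)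
open import Data.List.Membership.Propositional using (_∈_)
open import Data.List.Membership.Propositional.Properties using (∈-allFin; ∈-cartesianProduct⁺)
open import Data.List.Relation.Unary.Any using (here; there)
open import Data.List.Relation.Unary.All using (All; lookup)
open import Data.List.Relation.Unary.Unique.Propositional using (Unique)
open import Data.Product using (_×_; _,_; proj₁; proj₂; ∃; uncurry)
open import Data.Sum using (inj₁; inj₂)
open import Function using (_∘_)
open import Function.Bundles using (mk⇔)
open import Relation.Binary.Definitions using (tri<; tri≈; tri>)
open import Relation.Binary.PropositionalEquality
open import Relation.Nullary using (contradiction; no)

^-distribʳ-* : ∀ m n k → (m * n) ^ k ≡ m ^ k * n ^ k
^-distribʳ-* m n zero = refl
^-distribʳ-* m n (suc k) = trans (cong (m * n *_) (^-distribʳ-* m n k)) (interchange m n (m ^ k) (n ^ k))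
  where
  interchange : ∀ m n a b → m * n * (a * b) ≡ m * a * (n * b)
  interchange = solve-∀

n^n>0 : ∀ n → 0 < n ^ n
n^n>0 zero = z<s
n^n>0 (suc n) = m^n>0 (suc n) (suc n)

rearrangement : ∀ {a b c d} → a ≤ b → c ≤ d → a * d + b * c ≤ a * c + b * d
rearrangement {a} {b} {c} {d} a≤b c≤d with m≤n⇒∃[o]m+o≡n a≤b | m≤n⇒∃[o]m+o≡n c≤d
... | x , refl | y , refl =
  subst (a * (c + y) + (a + x) * c ≤_) (sym (expand a c x y)) (m≤m+n _ _)
  where
  expand : ∀ a c x y → a * c + (a + x) * (c + y) ≡ a * (c + y) + (a + x) * c + x * y
  expand = solve-∀

-- P and P^(n+1) are similarly ordered to Q and Q^(n+1).
power-rearrangement : ∀ n P Q → P * Q ^ suc n + Q * P ^ suc n ≤ P * P ^ suc n + Q * Q ^ suc n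
power-rearrangement n P Q with ≤-total P Q
... | inj₁ P≤Q = rearrangement P≤Q (^-monoˡ-≤ (suc n) P≤Q)
... | inj₂ Q≤P = subst₂ _≤_ (+-comm (Q * P ^ suc n) _) (+-comm (Q * Q ^ suc n) _)
                     (rearrangement Q≤P (^-monoˡ-≤ (suc n) Q≤P))

-- AM–GM for the n+1 numbers P^(n+1), Q^(n+1), …, Q^(n+1), cleared of roots.
amgm-power : ∀ n P Q → suc n * P * Q ^ n ≤ P ^ suc n + n * Q ^ suc n
amgm-power zero P Q = ≤-reflexive (normalise P Q)
  where
  normalise : ∀ P Q → 1 * P * 1 ≡ P * 1 + 0 * (Q * 1)
  normalise = solve-∀
amgm-power (suc n) P Q = begin
    (2 + n) * P * (Q * Qⁿ)
  ≡⟨ split n P Q Qⁿ ⟩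
    P * (Q * Qⁿ) + Q * ((1 + n) * P * Qⁿ)
  ≤⟨ +-monoʳ-≤ (P * (Q * Qⁿ)) (*-monoʳ-≤ Q (amgm-power n P Q)) ⟩
    P * (Q * Qⁿ) + Q * (P ^ suc n + n * (Q * Qⁿ))
  ≡⟨ regroup n P Q Qⁿ (P ^ suc n) ⟩
    (P * (Q * Qⁿ) + Q * P ^ suc n) + n * (Q * (Q * Qⁿ))
  ≤⟨ +-monoˡ-≤ _ (power-rearrangement n P Q) ⟩
    (P * P ^ suc n + Q * (Q * Qⁿ)) + n * (Q * (Q * Qⁿ))
  ≡⟨ collect n P Q Qⁿ (P ^ suc n) ⟩
    P * P ^ suc n + (1 + n) * (Q * (Q * Qⁿ))
  ∎
  where
  open ≤-Reasoning
  Qⁿ = Q ^ n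
  split : ∀ n P Q Qⁿ → (2 + n) * P * (Q * Qⁿ) ≡ P * (Q * Qⁿ) + Q * ((1 + n) * P * Qⁿ)
  split = solve-∀
  regroup : ∀ n P Q Qⁿ Pⁿ⁺¹ → P * (Q * Qⁿ) + Q * (Pⁿ⁺¹ + n * (Q * Qⁿ)) ≡ (P * (Q * Qⁿ) + Q * Pⁿ⁺¹) + n * (Q * (Q * Qⁿ))
  regroup = solve-∀
  collect : ∀ n P Q Qⁿ Pⁿ⁺¹ → (P * Pⁿ⁺¹ + Q * (Q * Qⁿ)) + n * (Q * (Q * Qⁿ)) ≡ P * Pⁿ⁺¹ + (1 + n) * (Q * (Q * Qⁿ))
  collect = solve-∀

-- The inductive step of AM–GM, cleared of fractions: (S/n)ⁿ · v is at most
-- ((S+v)/(n+1))^(n+1).  Derived from amgm-power with P = n(S+v), Q = (n+1)S.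
amgm-step : ∀ n S v → suc n ^ suc n * S ^ n * v ≤ n ^ n * (S + v) ^ suc n
amgm-step zero S v = subst₂ _≤_ (normaliseˡ v) (normaliseʳ S v) (m≤n+m v S)
  where
  normaliseˡ : ∀ v → v ≡ (1 * 1) * 1 * v
  normaliseˡ = solve-∀
  normaliseʳ : ∀ S v → S + v ≡ 1 * ((S + v) * 1)
  normaliseʳ = solve-∀
amgm-step (suc m) S v =
  *-cancelˡ-≤ N (+-cancelʳ-≤ C _ _ (subst₂ _≤_ lhs rhs (amgm-power N P Q)))
  where
  N = suc m
  P = N * (S + v)
  Q = suc N * S
  C = N * (Q * (suc N ^ N * S ^ N))
  expandˡ : ∀ N S v E F → (1 + N) * (N * (S + v)) * (E * F) ≡ N * ((1 + N) * E * F * v) + N * (((1 + N) * S) * (E * F))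
  expandˡ = solve-∀
  lhs : suc N * P * Q ^ N ≡ N * (suc N ^ suc N * S ^ N * v) + C
  lhs = trans (cong (suc N * P *_) (^-distribʳ-* (suc N) S N)) (expandˡ N S v (suc N ^ N) (S ^ N))
  expandʳ : ∀ N A B C → (N * A) * B + C ≡ N * (A * B) + C
  expandʳ = solve-∀
  rhs : P ^ suc N + N * Q ^ suc N ≡ N * (N ^ N * (S + v) ^ suc N) + C
  rhs rewrite ^-distribʳ-* N (S + v) (suc N) | ^-distribʳ-* (suc N) S N =
    expandʳ N (N ^ N) ((S + v) ^ suc N) C

-- Weighted AM–GM with two values u, v of integer weights p, q:
-- (u^p v^q)^(1/(p+q)) ≤ (pu + qv)/(p+q).  Induction on q via amgm-step.
amgm-two-values : ∀ p q u v → (p + q) ^ (p + q) * (u ^ p * v ^ q) ≤ (p * u + q * v) ^ (p + q)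
amgm-two-values p zero u v rewrite +-identityʳ p | +-identityʳ (p * u) | *-identityʳ (u ^ p) =
  ≤-reflexive (sym (^-distribʳ-* p u p))
amgm-two-values p (suc q) u v rewrite +-suc p q =
  *-cancelˡ-≤ (n ^ n) {{>-nonZero (n^n>0 n)}} (begin
    n ^ n * (K * (u ^ p * (v * v ^ q)))
  ≡⟨ reorder (n ^ n) K (u ^ p) v (v ^ q) ⟩
    K * v * (n ^ n * (u ^ p * v ^ q))
  ≤⟨ *-monoʳ-≤ (K * v) (amgm-two-values p q u v) ⟩
    K * v * S ^ n
  ≡⟨ swap-last K v (S ^ n) ⟩
    K * S ^ n * v
  ≤⟨ amgm-step n S v ⟩
    n ^ n * (S + v) ^ suc n
  ≡⟨ cong (λ t → n ^ n * t ^ suc n) (shift p q u v) ⟩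
    n ^ n * (p * u + (v + q * v)) ^ suc n
  ∎)
  where
  open ≤-Reasoning
  n = p + q
  S = p * u + q * v
  K = suc n ^ suc n
  shift : ∀ p q u v → (p * u + q * v) + v ≡ p * u + (v + q * v)
  shift = solve-∀
  reorder : ∀ a K b c d → a * (K * (b * (c * d))) ≡ K * c * (a * (b * d))
  reorder = solve-∀
  swap-last : ∀ K a b → K * a * b ≡ K * b * a
  swap-last = solve-∀

-- The two-point case of Gibbs' inequality, cleared of fractions:
-- x^p y^q ≤ (p/(p+q))^p (q/(p+q))^q (x+y)^(p+q).  For p, q > 0 it is
-- amgm-two-values at u = qx, v = py, divided by p^q q^p.
two-point-gibbs : ∀ p q x y → x ^ p * y ^ q * (p + q) ^ (p + q) ≤ (x + y) ^ (p + q) * (p ^ p * q ^ q)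
two-point-gibbs zero q x y =
  subst₂ _≤_ (normaliseˡ (y ^ q) (q ^ q)) (normaliseʳ ((x + y) ^ q) (q ^ q))
    (*-monoˡ-≤ (q ^ q) (^-monoˡ-≤ q (m≤n+m y x)))
  where
  normaliseˡ : ∀ a b → a * b ≡ 1 * a * b
  normaliseˡ = solve-∀
  normaliseʳ : ∀ a b → a * b ≡ a * (1 * b)
  normaliseʳ = solve-∀
two-point-gibbs (suc p) zero x y rewrite +-identityʳ p =
  subst₂ _≤_ (normaliseˡ (x ^ suc p) (suc p ^ suc p)) (normaliseʳ ((x + y) ^ suc p) (suc p ^ suc p))
    (*-monoˡ-≤ (suc p ^ suc p) (^-monoˡ-≤ (suc p) (m≤m+n x y)))
  where
  normaliseˡ : ∀ a b → a * b ≡ a * 1 * b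
  normaliseˡ = solve-∀
  normaliseʳ : ∀ a b → a * b ≡ a * (b * 1)
  normaliseʳ = solve-∀
two-point-gibbs p@(suc _) q@(suc _) x y = *-cancelˡ-≤ C {{m*n≢0 (p ^ q) (q ^ p) {{m^n≢0 p q}} {{m^n≢0 q p}}}} (begin
    C * (x ^ p * y ^ q * n ^ n)
  ≡⟨ reorder (p ^ q) (q ^ p) (x ^ p) (y ^ q) (n ^ n) ⟩
    n ^ n * ((x ^ p * q ^ p) * (y ^ q * p ^ q))
  ≡⟨ cong₂ (λ a b → n ^ n * (a * b)) (sym (^-distribʳ-* x q p)) (sym (^-distribʳ-* y p q)) ⟩
    n ^ n * ((x * q) ^ p * (y * p) ^ q)
  ≤⟨ amgm-two-values p q (x * q) (y * p) ⟩
    (p * (x * q) + q * (y * p)) ^ n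
  ≡⟨ cong (_^ n) (common-factor p q x y) ⟩
    (p * q * (x + y)) ^ n
  ≡⟨ ^-distribʳ-* (p * q) (x + y) n ⟩
    (p * q) ^ n * (x + y) ^ n
  ≡⟨ cong (_* (x + y) ^ n) (^-distribʳ-* p q n) ⟩
    p ^ n * q ^ n * (x + y) ^ n
  ≡⟨ cong₂ (λ a b → a * b * (x + y) ^ n) (^-distribˡ-+-* p p q) (^-distribˡ-+-* q p q) ⟩
    (p ^ p * p ^ q) * (q ^ p * q ^ q) * (x + y) ^ n
  ≡⟨ regroup (p ^ p) (p ^ q) (q ^ p) (q ^ q) ((x + y) ^ n) ⟩
    C * ((x + y) ^ n * (p ^ p * q ^ q))
  ∎)
  where
  open ≤-Reasoning
  n = p + q
  C = p ^ q * q ^ p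
  reorder : ∀ a b c d e → a * b * (c * d * e) ≡ e * ((c * b) * (d * a))
  reorder = solve-∀
  common-factor : ∀ p q x y → p * (x * q) + q * (y * p) ≡ p * q * (x + y)
  common-factor = solve-∀
  regroup : ∀ a b c d e → (a * b) * (c * d) * e ≡ b * c * (e * (a * d))
  regroup = solve-∀

square-gap : ∀ a b → (a + b) * (a + b) ≡ 4 * (a * b) + ∣ a - b ∣ * ∣ a - b ∣
square-gap a b with ≤-total a b
... | inj₁ a≤b with m≤n⇒∃[o]m+o≡n a≤b
...   | d , refl rewrite ∣m-m+n∣≡n a d = expand a d
  where
  expand : ∀ a d → (a + (a + d)) * (a + (a + d)) ≡ 4 * (a * (a + d)) + d * d
  expand = solve-∀
square-gap a b | inj₂ b≤a with m≤n⇒∃[o]m+o≡n b≤a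
...   | d , refl rewrite ∣-∣-comm (b + d) b | ∣m-m+n∣≡n b d = expand b d
  where
  expand : ∀ b d → (b + d + b) * (b + d + b) ≡ 4 * ((b + d) * b) + d * d
  expand = solve-∀

amgm-square : ∀ a b → 4 * (a * b) ≤ (a + b) * (a + b)
amgm-square a b rewrite square-gap a b = m≤m+n _ _

amgm-square-equality : ∀ a b → 4 * (a * b) ≡ (a + b) * (a + b) → a ≡ b
amgm-square-equality a b eq = ∣m-n∣≡0⇒m≡n (m^n≡0⇒m≡0 ∣ a - b ∣ 2 gap≡0)
  where
  gap≡0 : ∣ a - b ∣ * (∣ a - b ∣ * 1) ≡ 0
  gap≡0 rewrite *-identityʳ ∣ a - b ∣ =
    +-cancelˡ-≡ (4 * (a * b)) _ 0 (trans (sym (square-gap a b)) (trans (sym eq) (sym (+-identityʳ _))))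

*-pos⁻¹ : ∀ m n → 0 < m * n → 0 < m × 0 < n
*-pos⁻¹ (suc m) (suc n) _ = z<s , z<s
*-pos⁻¹ (suc m) zero m*0>0 = contradiction (*-zeroʳ m) (>⇒≢ m*0>0)

^-injectiveˡ : ∀ {x y} k → 0 < k → x ^ k ≡ y ^ k → x ≡ y
^-injectiveˡ {x} {y} k 0<k eq with <-cmp x y
... | tri< x<y _ _ = contradiction eq (<⇒≢ (^-monoˡ-< k {{>-nonZero 0<k}} x<y))
... | tri≈ _ x≡y _ = x≡y
... | tri> _ _ y<x = contradiction (sym eq) (<⇒≢ (^-monoˡ-< k {{>-nonZero 0<k}} y<x))

module _ {X : Set} where
  ∑ : List X → (X → ℕ) → ℕ
  ∑ xs f = sum (map f xs)

  ∏ : List X → (X → ℕ) → ℕ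
  ∏ xs f = product (map f xs)

  ∑-+ : ∀ xs f g → ∑ xs (λ x → f x + g x) ≡ ∑ xs f + ∑ xs g
  ∑-+ [] f g = refl
  ∑-+ (x ∷ xs) f g rewrite ∑-+ xs f g = +-+-interchange (f x) (g x) (∑ xs f) (∑ xs g)
    where
    +-+-interchange : ∀ a b c d → a + b + (c + d) ≡ a + c + (b + d)
    +-+-interchange = solve-∀

  ∏-* : ∀ xs f g → ∏ xs (λ x → f x * g x) ≡ ∏ xs f * ∏ xs g
  ∏-* [] f g = refl
  ∏-* (x ∷ xs) f g rewrite ∏-* xs f g = *-*-interchange (f x) (g x) (∏ xs f) (∏ xs g)
    where
    *-*-interchange : ∀ a b c d → a * b * (c * d) ≡ a * c * (b * d)
    *-*-interchange = solve-∀

  ∏-1 : ∀ xs → ∏ xs (λ _ → 1) ≡ 1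
  ∏-1 [] = refl
  ∏-1 (x ∷ xs) rewrite ∏-1 xs = refl

  ∏-cong : ∀ xs {f g} → (∀ {x} → x ∈ xs → f x ≡ g x) → ∏ xs f ≡ ∏ xs g
  ∏-cong [] f≡g = refl
  ∏-cong (x ∷ xs) f≡g = cong₂ _*_ (f≡g (here refl)) (∏-cong xs (f≡g ∘ there))

  ∏-mono-≤ : ∀ xs {f g} → (∀ {x} → x ∈ xs → f x ≤ g x) → ∏ xs f ≤ ∏ xs g
  ∏-mono-≤ [] f≤g = ≤-refl
  ∏-mono-≤ (x ∷ xs) f≤g = *-mono-≤ (f≤g (here refl)) (∏-mono-≤ xs (f≤g ∘ there))

  ∏-pos : ∀ xs {f} → (∀ {x} → x ∈ xs → 0 < f x) → 0 < ∏ xs f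
  ∏-pos [] f>0 = z<s
  ∏-pos (x ∷ xs) f>0 =
    >-nonZero⁻¹ _ {{m*n≢0 _ _ {{>-nonZero (f>0 (here refl))}} {{>-nonZero (∏-pos xs (f>0 ∘ there))}}}}

  -- If f ≤ g pointwise, g is positive, and the products are equal
  -- (∏ g ≤ ∏ f), then f = g pointwise: no factor can absorb a deficit.
  ∏-tight : ∀ xs {f g} → (∀ {x} → x ∈ xs → f x ≤ g x) → (∀ {x} → x ∈ xs → 0 < g x) →
            ∏ xs g ≤ ∏ xs f → ∀ {x} → x ∈ xs → f x ≡ g x
  ∏-tight (y ∷ xs) {f} {g} f≤g g>0 ∏g≤∏f {x} x∈ = at x∈
    where
    instance
      gy≢0 : NonZero (g y)
      gy≢0 = >-nonZero (g>0 (here refl))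
      ∏g≢0 : NonZero (∏ xs g)
      ∏g≢0 = >-nonZero (∏-pos xs (g>0 ∘ there))
    gy≤fy : g y ≤ f y
    gy≤fy = *-cancelʳ-≤ (g y) (f y) (∏ xs g)
      (≤-trans ∏g≤∏f (*-monoʳ-≤ (f y) (∏-mono-≤ xs (f≤g ∘ there))))
    fy≡gy : f y ≡ g y
    fy≡gy = ≤-antisym (f≤g (here refl)) gy≤fy
    rest : ∏ xs g ≤ ∏ xs f
    rest = *-cancelˡ-≤ (g y) (subst (λ t → g y * ∏ xs g ≤ t * ∏ xs f) fy≡gy ∏g≤∏f)
    at : ∀ {x} → x ∈ y ∷ xs → f x ≡ g x
    at (here refl) = fy≡gy
    at (there x∈xs) = ∏-tight xs (f≤g ∘ there) (g>0 ∘ there) rest x∈xs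

module _ {A B : Set} where
  ∏-swap : ∀ (xs : List A) (ys : List B) (F : A → B → ℕ) →
           ∏ xs (λ x → ∏ ys (F x)) ≡ ∏ ys (λ y → ∏ xs (λ x → F x y))
  ∏-swap [] ys F = sym (∏-1 ys)
  ∏-swap (x ∷ xs) ys F rewrite ∏-swap xs ys F = sym (∏-* ys (F x) (λ y → ∏ xs (λ x → F x y)))

  module _ {C : Set} (_∙_ : C → C → C) (ε : C)
           (fold-++ : ∀ us vs → foldr _∙_ ε (us ++ vs) ≡ foldr _∙_ ε us ∙ foldr _∙_ ε vs) where
    private
      fold : List C → C
      fold = foldr _∙_ ε

    fold-cartesianProduct : ∀ (xs : List A) (ys : List B) (F : A → B → C) →
      fold (map (λ x → fold (map (F x) ys)) xs) ≡ fold (map (uncurry F) (cartesianProduct xs ys))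
    fold-cartesianProduct [] ys F = refl
    fold-cartesianProduct (x ∷ xs) ys F = begin
        fold (map (F x) ys) ∙ fold (map (λ x → fold (map (F x) ys)) xs)
      ≡⟨ cong₂ _∙_ (cong fold (map-∘ ys)) (fold-cartesianProduct xs ys F) ⟩
        fold (map (uncurry F) (map (x ,_) ys)) ∙ fold (map (uncurry F) (cartesianProduct xs ys))
      ≡⟨ fold-++ (map (uncurry F) (map (x ,_) ys)) _ ⟨
        fold (map (uncurry F) (map (x ,_) ys) ++ map (uncurry F) (cartesianProduct xs ys))
      ≡⟨ cong fold (map-++ (uncurry F) (map (x ,_) ys) (cartesianProduct xs ys)) ⟨
        fold (map (uncurry F) (map (x ,_) ys ++ cartesianProduct xs ys))
      ∎
      where open ≡-Reasoning

  ∑-cartesianProduct : ∀ (xs : List A) (ys : List B) (F : A → B → ℕ) →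
    sum (map (λ x → sum (map (F x) ys)) xs) ≡ ∑ (cartesianProduct xs ys) (uncurry F)
  ∑-cartesianProduct = fold-cartesianProduct _+_ 0 sum-++

  ∏-cartesianProduct : ∀ (xs : List A) (ys : List B) (F : A → B → ℕ) →
    product (map (λ x → product (map (F x) ys)) xs) ≡ ∏ (cartesianProduct xs ys) (uncurry F)
  ∏-cartesianProduct = fold-cartesianProduct _*_ 1 product-++

-- Weighted AM–GM for weights aᵢ and values bᵢ/aᵢ, cleared of fractions:
-- Π (bᵢ/aᵢ)^aᵢ ≤ (B/A)^A with A = Σ aᵢ, B = Σ bᵢ.  Induction on the list,
-- merging the head into the tail by two-point-gibbs.
weighted-amgm : ∀ {X : Set} (xs : List X) a b →
  ∑ xs a ^ ∑ xs a * ∏ xs (λ x → b x ^ a x) ≤ ∑ xs b ^ ∑ xs a * ∏ xs (λ x → a x ^ a x)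
weighted-amgm [] a b = ≤-refl
weighted-amgm (x ∷ xs) a b = *-cancelˡ-≤ (A ^ A) {{>-nonZero (n^n>0 A)}} (begin
    A ^ A * (M * (b x ^ a x * ∏b))
  ≡⟨ reorder (A ^ A) M (b x ^ a x) ∏b ⟩
    M * b x ^ a x * (A ^ A * ∏b)
  ≤⟨ *-monoʳ-≤ (M * b x ^ a x) (weighted-amgm xs a b) ⟩
    M * b x ^ a x * (B ^ A * ∏a)
  ≡⟨ regroup M (b x ^ a x) (B ^ A) ∏a ⟩
    b x ^ a x * B ^ A * M * ∏a
  ≤⟨ *-monoˡ-≤ ∏a (two-point-gibbs (a x) A (b x) B) ⟩
    (b x + B) ^ (a x + A) * (a x ^ a x * A ^ A) * ∏a
  ≡⟨ collect ((b x + B) ^ (a x + A)) (a x ^ a x) (A ^ A) ∏a ⟩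
    A ^ A * ((b x + B) ^ (a x + A) * (a x ^ a x * ∏a))
  ∎)
  where
  open ≤-Reasoning
  A = ∑ xs a
  B = ∑ xs b
  M = (a x + A) ^ (a x + A)
  ∏b = ∏ xs (λ x → b x ^ a x)
  ∏a = ∏ xs (λ x → a x ^ a x)
  reorder : ∀ a m c d → a * (m * (c * d)) ≡ m * c * (a * d)
  reorder = solve-∀
  regroup : ∀ m c d e → m * c * (d * e) ≡ c * d * m * e
  regroup = solve-∀
  collect : ∀ a b c d → a * (b * c) * d ≡ c * (a * (b * d))
  collect = solve-∀

gibbs : ∀ {X : Set} (xs : List X) a b → ∑ xs b ≤ ∑ xs a →
        ∏ xs (λ x → b x ^ a x) ≤ ∏ xs (λ x → a x ^ a x)
gibbs xs a b B≤A = *-cancelˡ-≤ (A ^ A) {{>-nonZero (n^n>0 A)}} (begin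
    A ^ A * ∏ xs (λ x → b x ^ a x)
  ≤⟨ weighted-amgm xs a b ⟩
    ∑ xs b ^ A * ∏ xs (λ x → a x ^ a x)
  ≤⟨ *-monoˡ-≤ _ (^-monoˡ-≤ A B≤A) ⟩
    A ^ A * ∏ xs (λ x → a x ^ a x)
  ∎)
  where
  open ≤-Reasoning
  A = ∑ xs a

^-square : ∀ c k → (c * c) ^ k ≡ c ^ (k + k)
^-square c k = trans (^-distribʳ-* c c k) (sym (^-distribˡ-+-* c k k))

^-4ab : ∀ a b → (4 * (a * b)) ^ a ≡ 4 ^ a * (a ^ a * b ^ a)
^-4ab a b = trans (^-distribʳ-* 4 (a * b) a) (cong (4 ^ a *_) (^-distribʳ-* a b a))

^-2a : ∀ a → (a + a) ^ (a + a) ≡ 4 ^ a * (a ^ a * a ^ a)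
^-2a a = begin
    (a + a) ^ (a + a)        ≡⟨ ^-square (a + a) a ⟨
    ((a + a) * (a + a)) ^ a  ≡⟨ cong (_^ a) (double-square a) ⟩
    (4 * (a * a)) ^ a        ≡⟨ ^-4ab a a ⟩
    4 ^ a * (a ^ a * a ^ a)  ∎
  where
  open ≡-Reasoning
  double-square : ∀ a → (a + a) * (a + a) ≡ 4 * (a * a)
  double-square = solve-∀

-- Equality in Gibbs' inequality forces bᵢ = aᵢ whenever aᵢ > 0.  Apply
-- Gibbs to the weights 2aᵢ and values aᵢ + bᵢ and compare with the
-- pointwise bound (4aᵢbᵢ)^aᵢ ≤ ((aᵢ+bᵢ)²)^aᵢ: the products of both sides
-- coincide, so each factor is tight and 4aᵢbᵢ = (aᵢ+bᵢ)².
gibbs-equality : ∀ {X : Set} (xs : List X) a b → ∑ xs b ≤ ∑ xs a →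
  ∏ xs (λ x → b x ^ a x) ≡ ∏ xs (λ x → a x ^ a x) →
  ∀ {x} → x ∈ xs → 0 < a x → b x ≡ a x
gibbs-equality {X} xs a b B≤A ∏≡ {x} x∈xs ax>0 =
  sym (amgm-square-equality (a x) (b x)
        (^-injectiveˡ (a x) ax>0 (∏-tight xs F≤G G>0 ∏G≤∏F x∈xs)))
  where
  F G : X → ℕ
  F x = (4 * (a x * b x)) ^ a x
  G x = ((a x + b x) * (a x + b x)) ^ a x
  F≤G : ∀ {x} → x ∈ xs → F x ≤ G x
  F≤G {x} _ = ^-monoˡ-≤ (a x) (amgm-square (a x) (b x))
  G>0 : ∀ {x} → x ∈ xs → 0 < G x
  G>0 {x} _ with a x
  ... | zero = z<s
  ... | suc k = m^n>0 ((suc k + b x) * (suc k + b x)) (suc k)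
  ∏4ᵃ = ∏ xs (λ x → 4 ^ a x)
  ∏aᵃ = ∏ xs (λ x → a x ^ a x)
  ∏-4ᵃ : ∀ c → ∏ xs (λ x → 4 ^ a x * (a x ^ a x * c x ^ a x)) ≡ ∏4ᵃ * (∏aᵃ * ∏ xs (λ x → c x ^ a x))
  ∏-4ᵃ c = trans (∏-* xs _ _) (cong (∏4ᵃ *_) (∏-* xs _ _))
  sum-bound : ∑ xs (λ x → a x + b x) ≤ ∑ xs (λ x → a x + a x)
  sum-bound rewrite ∑-+ xs a b | ∑-+ xs a a = +-monoʳ-≤ (∑ xs a) B≤A
  ∏G≤∏F : ∏ xs G ≤ ∏ xs F
  ∏G≤∏F = begin
      ∏ xs G
    ≡⟨ ∏-cong xs (λ {x} _ → ^-square (a x + b x) (a x)) ⟩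
      ∏ xs (λ x → (a x + b x) ^ (a x + a x))
    ≤⟨ gibbs xs (λ x → a x + a x) (λ x → a x + b x) sum-bound ⟩
      ∏ xs (λ x → (a x + a x) ^ (a x + a x))
    ≡⟨ ∏-cong xs (λ {x} _ → ^-2a (a x)) ⟩
      ∏ xs (λ x → 4 ^ a x * (a x ^ a x * a x ^ a x))
    ≡⟨ ∏-4ᵃ a ⟩
      ∏4ᵃ * (∏aᵃ * ∏aᵃ)
    ≡⟨ cong (λ t → ∏4ᵃ * (∏aᵃ * t)) ∏≡ ⟨
      ∏4ᵃ * (∏aᵃ * ∏ xs (λ x → b x ^ a x))
    ≡⟨ ∏-4ᵃ b ⟨
      ∏ xs (λ x → 4 ^ a x * (a x ^ a x * b x ^ a x))
    ≡⟨ ∏-cong xs (λ {x} _ → ^-4ab (a x) (b x)) ⟨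
      ∏ xs F
    ∎
    where open ≤-Reasoning

count : ∀ {S : Set} → (S → Bool) → List S → ℕ
count s Ls = length (filter (λ L → T? (s L)) Ls)

count-witness : ∀ {S : Set} (s : S → Bool) Ls → 0 < count s Ls → ∃ λ L → L ∈ Ls × s L ≡ true
count-witness s (L ∷ Ls) count>0 with s L in sL
... | true = L , here refl , sL
... | false with count-witness s Ls count>0
...   | L′ , L′∈Ls , sL′ = L′ , there L′∈Ls , sL′

mask : Bool → ℕ → ℕ
mask b x = if b then x else 0

mask-true : ∀ {b} x → b ≡ true → mask b x ≡ x
mask-true x refl = refl

-- An exponent counting members of a list splits into one factor per member;
-- written with masks, uncounted members contribute 0⁰ = 1.
^-count : ∀ {S : Set} (s : S → Bool) Ls x c →
  x ^ (c * count s Ls) ≡ ∏ Ls (λ L → mask (s L) x ^ mask (s L) c)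
^-count s [] x c rewrite *-zeroʳ c = refl
^-count s (L ∷ Ls) x c with s L
... | false = trans (^-count s Ls x c) (sym (+-identityʳ _))
... | true = begin
    x ^ (c * suc (count s Ls))       ≡⟨ cong (x ^_) (*-suc c (count s Ls)) ⟩
    x ^ (c + c * count s Ls)         ≡⟨ ^-distribˡ-+-* x c (c * count s Ls) ⟩
    x ^ c * x ^ (c * count s Ls)     ≡⟨ cong (x ^ c *_) (^-count s Ls x c) ⟩
    x ^ c * ∏ Ls (λ L → mask (s L) x ^ mask (s L) c)  ∎
  where open ≡-Reasoning

^-count-guarded : ∀ {S : Set} (s : S → Bool) Ls (d : Bool) x c →
  (∀ {L} → L ∈ Ls → s L ≡ true → d ≡ true) →
  (if d then x ^ (c * count s Ls) else 1) ≡ ∏ Ls (λ L → mask (s L) x ^ mask (s L) c)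
^-count-guarded s Ls true x c _ = ^-count s Ls x c
^-count-guarded s Ls false x c s⇒d = sym (trans (∏-cong Ls uncounted) (∏-1 Ls))
  where
  uncounted : ∀ {L} → L ∈ Ls → mask (s L) x ^ mask (s L) c ≡ 1
  uncounted {L} L∈Ls with s L in sL
  ... | false = refl
  ... | true with () ← s⇒d L∈Ls sL

subgraph-arcStar : ∀ G L → IsSubgraph G L → ∀ v w → arcLStarᵇ G L v w ≡ true → arcStarᵇ G v w ≡ true
subgraph-arcStar G L (_ , arcs⊆ , _) v w e with inA L v w in inL
... | true rewrite arcs⊆ v w inL = e

arcStarᵇ-sound : ∀ G v w → arcStarᵇ G v w ≡ true → ArcStar G v w
arcStarᵇ-sound G v w e with arc G v w | v ≟ w
... | true | no v≢w = refl , v≢w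

module _ (G H : Digraph) where
  vertices : List (V G)
  vertices = allFin (suc (size G))

  pairs : List (V G × V G)
  pairs = cartesianProduct vertices vertices

  ιᴸ : SubG G → (V G → V H) → V G × V G → ℕ
  ιᴸ L ξ = uncurry (λ v w → mask (arcLStarᵇ G L v w) (ιξ G H ξ v w))

  μ-as-sum : ∀ L ξ → μ G L H ξ ≡ ∑ pairs (ιᴸ L ξ)
  μ-as-sum L ξ = ∑-cartesianProduct vertices vertices _

  -- The factor of π_γ(ξ) contributed by one subgraph L.
  factor : SubG G → (V G → V H) → (V G → V H) → ℕ
  factor L ζ ξ = ∏ pairs (λ e → ιᴸ L ξ e ^ ιᴸ L ζ e)

  π-factorisation : ∀ 𝓛 → All (IsSubgraph G) 𝓛 → ∀ ζ ξ →
    π G H (γ G H 𝓛 ζ) ξ ≡ ∏ 𝓛 (λ L → factor L ζ ξ)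
  π-factorisation 𝓛 subs ζ ξ = begin
      π G H (γ G H 𝓛 ζ) ξ
    ≡⟨ ∏-cartesianProduct vertices vertices arc-term ⟩
      ∏ pairs (uncurry arc-term)
    ≡⟨ ∏-cong pairs (λ {(v , w)} _ → ^-count-guarded (λ L → arcLStarᵇ G L v w) 𝓛 (arcStarᵇ G v w)
                                       (ιξ G H ξ v w) (ιξ G H ζ v w)
                                       (λ {L} L∈ → subgraph-arcStar G L (lookup subs L∈) v w)) ⟩
      ∏ pairs (λ e → ∏ 𝓛 (λ L → ιᴸ L ξ e ^ ιᴸ L ζ e))
    ≡⟨ ∏-swap pairs 𝓛 (λ e L → ιᴸ L ξ e ^ ιᴸ L ζ e) ⟩
      ∏ 𝓛 (λ L → factor L ζ ξ)
    ∎
    where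
    open ≡-Reasoning
    arc-term : V G → V G → ℕ
    arc-term v w = if arcStarᵇ G v w then ιξ G H ξ v w ^ γ G H 𝓛 ζ v w else 1

  module _ (𝓛 : List (SubG G)) (subs : All (IsSubgraph G) 𝓛)
           (ζ : V G → V H) (ζ∈M : InML G H 𝓛 ζ) where

    hom-restricts : ∀ ξ → IsHom G H ξ → ∀ {L} → L ∈ 𝓛 → IsHomSub G L H ξ
    hom-restricts ξ ξ-hom L∈ v w vw∈L = ξ-hom v w (proj₁ (proj₂ (lookup subs L∈)) v w vw∈L)

    μ-bound : ∀ ξ → IsHom G H ξ → ∀ {L} → L ∈ 𝓛 → ∑ pairs (ιᴸ L ξ) ≤ ∑ pairs (ιᴸ L ζ)
    μ-bound ξ ξ-hom {L} L∈ =
      subst₂ _≤_ (μ-as-sum L ξ) (μ-as-sum L ζ) (proj₂ (proj₂ ζ∈M L L∈) ξ (hom-restricts ξ ξ-hom L∈))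

    factor-bound : ∀ ξ → IsHom G H ξ → ∀ {L} → L ∈ 𝓛 → factor L ζ ξ ≤ factor L ζ ζ
    factor-bound ξ ξ-hom {L} L∈ = gibbs pairs (ιᴸ L ζ) (ιᴸ L ξ) (μ-bound ξ ξ-hom L∈)

    factor-pos : ∀ {L} → L ∈ 𝓛 → 0 < factor L ζ ζ
    factor-pos {L} _ = ∏-pos pairs (λ {e} _ → n^n>0 (ιᴸ L ζ e))

    π-bound : ∀ ξ → IsHom G H ξ → π G H (γ G H 𝓛 ζ) ξ ≤ π G H (γ G H 𝓛 ζ) ζ
    π-bound ξ ξ-hom = subst₂ _≤_ (sym (π-factorisation 𝓛 subs ζ ξ)) (sym (π-factorisation 𝓛 subs ζ ζ))
                        (∏-mono-≤ 𝓛 (factor-bound ξ ξ-hom))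

    -- Equal π_γ-values force every factor, hence ιᴸ_ξ where ιᴸ_ζ > 0, to
    -- agree with ζ; an arc of D(γ) has ι_ζ > 0 and lies in some L* with L ∈ 𝓛.
    π-equal⇒agree : ∀ ξ → IsHom G H ξ → π G H (γ G H 𝓛 ζ) ξ ≡ π G H (γ G H 𝓛 ζ) ζ →
                    AgreeOnD G H (γ G H 𝓛 ζ) ξ ζ
    π-equal⇒agree ξ ξ-hom π≡ v w _ γ>0 with *-pos⁻¹ (ιξ G H ζ v w) _ γ>0
    ... | ιζ>0 , count>0 with count-witness (λ L → arcLStarᵇ G L v w) 𝓛 count>0
    ...   | L , L∈ , vw∈L =
      trans (sym (mask-true _ vw∈L)) (trans ιᴸ-agree (mask-true _ vw∈L))
      where
      factors-equal : factor L ζ ξ ≡ factor L ζ ζ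
      factors-equal = ∏-tight 𝓛 (factor-bound ξ ξ-hom) factor-pos
        (≤-reflexive (trans (sym (π-factorisation 𝓛 subs ζ ζ)) (trans (sym π≡) (π-factorisation 𝓛 subs ζ ξ))))
        L∈
      ιᴸ-agree : ιᴸ L ξ (v , w) ≡ ιᴸ L ζ (v , w)
      ιᴸ-agree = gibbs-equality pairs (ιᴸ L ζ) (ιᴸ L ξ) (μ-bound ξ ξ-hom L∈) factors-equal
        (∈-cartesianProduct⁺ (∈-allFin v) (∈-allFin w)) (subst (0 <_) (sym (mask-true _ vw∈L)) ιζ>0)

    agree⇒π-equal : ∀ ξ → AgreeOnD G H (γ G H 𝓛 ζ) ξ ζ → π G H (γ G H 𝓛 ζ) ξ ≡ π G H (γ G H 𝓛 ζ) ζ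
    agree⇒π-equal ξ agree = ∏-cong vertices (λ {v} _ → ∏-cong vertices (λ {w} _ → same-term v w))
      where
      same-term : ∀ v w → (if arcStarᵇ G v w then ιξ G H ξ v w ^ γ G H 𝓛 ζ v w else 1)
                        ≡ (if arcStarᵇ G v w then ιξ G H ζ v w ^ γ G H 𝓛 ζ v w else 1)
      same-term v w with arcStarᵇ G v w in vw∈ | γ G H 𝓛 ζ v w in γvw
      ... | false | _ = refl
      ... | true | zero = refl
      ... | true | suc k = cong (_^ suc k) (agree v w (arcStarᵇ-sound G v w vw∈) (subst (0 <_) (sym γvw) z<s))

theorem3 : (G H : Digraph) → Reflexive H →
    (𝓛 : List (SubG G)) → All (IsSubgraph G) 𝓛 → Unique 𝓛 →
    (ζ : V G → V H) → InML G H 𝓛 ζ →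
    Selecting G H (γ G H 𝓛 ζ) ζ
theorem3 G H _ 𝓛 subs _ ζ ζ∈M ξ ξ-hom =
  π-bound G H 𝓛 subs ζ ζ∈M ξ ξ-hom ,
  mk⇔ (π-equal⇒agree G H 𝓛 subs ζ ζ∈M ξ ξ-hom) (agree⇒π-equal G H 𝓛 subs ζ ζ∈M ξ)
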